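{- Let $K$ be a field, let $A\in K[X]$ be monic of degree $2$, and let $R(X)=v(X-w)$ with $v,w\in K$, $v\neq 0$. Suppose that for all $h\in\mathbb Z$ we are given $e_h\in K$, polynomials $Q_h(X)=v_h(X-w_h)$ with $v_h,w_h\in K$, $v_h\neq 0$, and $a_h\in K[X]$, such that $$e_h+e_{h+1}+A=a_hQ_h\qquad\text{and}\qquad -Q_hQ_{h+1}=-R+e_{h+1}(A+e_{h+1}).$$ Let $(A_h)_{h\in\mathbb Z}$ be a sequence of nonzero elements of $K$ with $A_{h-1}A_{h+1}=e_hA_h^2$ for all $h$. Then for all $h$, $$A_{h-2}A_{h+2}=v^2A_{h-1}A_{h+1}+v^2A(w)A_h^2.$$
   Context: The data $(e_h,Q_h,a_h)$ are those of the normal continued fraction expansion of $(Z+e_0)/Q_0$ where $Z^2-AZ-R=0$; in the paper $A_h^2$ is the denominator of $e_h$ when $K=\mathbb Q$. -}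

module Defs where

open import Level using (Level; suc; _⊔_)
open import Algebra.Bundles using (CommutativeRing)
open import Data.List using (List; []; _∷_; map)
open import Data.Nat using (ℕ; zero) renaming (suc to sucℕ)
open import Data.Product using (∃)
open import Relation.Nullary using (¬_)

record Field (c ℓ : Level) : Set (suc (c ⊔ ℓ)) where
  field
    commutativeRing : CommutativeRing c ℓ
  open CommutativeRing commutativeRing public
  field
    0≉1     : ¬ (0# ≈ 1#)
    inverse : ∀ x → ¬ (x ≈ 0#) → ∃ λ y → x * y ≈ 1#

-- Univariate polynomials K[X] over a field, as lists of coefficients
-- in ascending degree order; equality is coefficientwise (trailing zeros ignored).
module Poly {c ℓ : Level} (K : Field c ℓ) where
  open Field K

  Pol : Set c
  Pol = List Carrier

  coeff : Pol → ℕ → Carrier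
  coeff []       _        = 0#
  coeff (a ∷ p)  zero     = a
  coeff (a ∷ p)  (sucℕ n) = coeff p n

  _≈P_ : Pol → Pol → Set ℓ
  p ≈P q = ∀ n → coeff p n ≈ coeff q n

  infixl 6 _+P_
  infixl 7 _*P_

  _+P_ : Pol → Pol → Pol
  []      +P q       = q
  (a ∷ p) +P []      = a ∷ p
  (a ∷ p) +P (b ∷ q) = (a + b) ∷ (p +P q)

  scale : Carrier → Pol → Pol
  scale a = map (a *_)

  _*P_ : Pol → Pol → Pol
  []      *P q = []
  (a ∷ p) *P q = scale a q +P (0# ∷ (p *P q))

  negP : Pol → Pol
  negP = map (-_)

  const : Carrier → Pol
  const a = a ∷ []

  lin : Carrier → Carrier → Pol
  lin v w = (- (v * w)) ∷ v ∷ []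

  monic2 : Carrier → Carrier → Pol
  monic2 c0 c1 = c0 ∷ c1 ∷ 1# ∷ []

  eval : Pol → Carrier → Carrier
  eval []      x = 0#
  eval (a ∷ p) x = a + x * eval p x

{-# OPTIONS --safe #-}
-- Evaluating the two polynomial identities at the root wₕ of Qₕ gives
-- eₕ eₕ₊₁ = v (w - wₕ); evaluating the second one at w and comparing X²
-- coefficients gives (w - wₕ₋₁)(w - wₕ) = A(w) + eₕ.  On the other hand
-- the recurrence Aₕ₋₁Aₕ₊₁ = eₕAₕ² gives Aₕ₋₂Aₕ₊₂ = (eₕ₋₁eₕ)(eₕeₕ₊₁)Aₕ²,
-- and substituting the two identities yields the claim.
module Submission where

open import Defs
open import Level using (Level)
open import Data.Integer using (ℤ; +_) renaming (_+_ to _+ℤ_; _-_ to _-ℤ_)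
import Data.Integer.Properties as ℤ
open import Data.Nat using (suc)
open import Data.List using ([]; _∷_)
open import Data.Product using (_,_)
open import Relation.Nullary using (¬_)
open import Relation.Binary.PropositionalEquality as ≡ using (_≡_; subst)
import Algebra.Properties.Ring as RingProperties
import Algebra.Solver.Ring.NaturalCoefficients.Default as NaturalSolver
import Relation.Binary.Reasoning.Setoid as ≈-Reasoning

i-1+1≡i : ∀ i → i -ℤ + 1 +ℤ + 1 ≡ i
i-1+1≡i i = ≡.trans (ℤ.+-assoc i _ _) (ℤ.+-identityʳ i)

i+1-1≡i : ∀ i → i +ℤ + 1 -ℤ + 1 ≡ i
i+1-1≡i i = ≡.trans (ℤ.+-assoc i _ _) (ℤ.+-identityʳ i)

i-1-1≡i-2 : ∀ i → i -ℤ + 1 -ℤ + 1 ≡ i -ℤ + 2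
i-1-1≡i-2 i = ℤ.+-assoc i _ _

i+1+1≡i+2 : ∀ i → i +ℤ + 1 +ℤ + 1 ≡ i +ℤ + 2
i+1+1≡i+2 i = ℤ.+-assoc i _ _

at-pred : ∀ {p} {P : ℤ → ℤ → Set p} → (∀ i → P i (i +ℤ + 1)) → ∀ i → P (i -ℤ + 1) i
at-pred {P = P} f i = subst (P (i -ℤ + 1)) (i-1+1≡i i) (f (i -ℤ + 1))

module FieldProperties {c ℓ} (K : Field c ℓ) where
  open Field K
  open NaturalSolver commutativeSemiring
  open ≈-Reasoning setoid

  *-cancelˡ-nonZero : ∀ x y z → ¬ x ≈ 0# → x * y ≈ x * z → y ≈ z
  *-cancelˡ-nonZero x y z x≉0 xy≈xz with inverse x x≉0
  ... | x⁻¹ , xx⁻¹≈1 = begin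
    y               ≈⟨ unit y ⟨
    x⁻¹ * (x * y)   ≈⟨ *-congˡ xy≈xz ⟩
    x⁻¹ * (x * z)   ≈⟨ unit z ⟩
    z               ∎
    where
    unit : ∀ u → x⁻¹ * (x * u) ≈ u
    unit u = begin
      x⁻¹ * (x * u)  ≈⟨ solve 3 (λ x x⁻¹ u → x⁻¹ :* (x :* u) := (x :* x⁻¹) :* u) refl x x⁻¹ u ⟩
      (x * x⁻¹) * u  ≈⟨ *-congʳ xx⁻¹≈1 ⟩
      1# * u         ≈⟨ *-identityˡ u ⟩
      u              ∎

  x≉0∧y≉0⇒xy≉0 : ∀ {x y} → ¬ x ≈ 0# → ¬ y ≈ 0# → ¬ x * y ≈ 0#
  x≉0∧y≉0⇒xy≉0 {x} {y} x≉0 y≉0 xy≈0 =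
    y≉0 (*-cancelˡ-nonZero x y 0# x≉0 (trans xy≈0 (sym (zeroʳ x))))

module Evaluation {c ℓ} (K : Field c ℓ) where
  open Field K
  open Poly K
  open RingProperties ring
  open NaturalSolver commutativeSemiring
  open ≈-Reasoning setoid

  eval-zero : ∀ p x → [] ≈P p → eval p x ≈ 0#
  eval-zero []      x p≈0 = refl
  eval-zero (b ∷ p) x p≈0 = begin
    b + x * eval p x  ≈⟨ +-cong (sym (p≈0 0)) (*-congˡ (eval-zero p x (λ n → p≈0 (suc n)))) ⟩
    0# + x * 0#       ≈⟨ +-identityˡ _ ⟩
    x * 0#            ≈⟨ zeroʳ x ⟩
    0#                ∎

  eval-cong : ∀ p q x → p ≈P q → eval p x ≈ eval q x
  eval-cong []      q       x p≈q = sym (eval-zero q x p≈q)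
  eval-cong (a ∷ p) []      x p≈q = eval-zero (a ∷ p) x (λ n → sym (p≈q n))
  eval-cong (a ∷ p) (b ∷ q) x p≈q =
    +-cong (p≈q 0) (*-congˡ (eval-cong p q x (λ n → p≈q (suc n))))

  eval-+P : ∀ p q x → eval (p +P q) x ≈ eval p x + eval q x
  eval-+P []      q       x = sym (+-identityˡ _)
  eval-+P (a ∷ p) []      x = sym (+-identityʳ _)
  eval-+P (a ∷ p) (b ∷ q) x = begin
    (a + b) + x * eval (p +P q) x        ≈⟨ +-congˡ (*-congˡ (eval-+P p q x)) ⟩
    (a + b) + x * (eval p x + eval q x)  ≈⟨ solve 5 (λ a b x P Q →
                                              (a :+ b) :+ x :* (P :+ Q) := (a :+ x :* P) :+ (b :+ x :* Q))
                                              refl a b x (eval p x) (eval q x) ⟩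
    (a + x * eval p x) + (b + x * eval q x) ∎

  eval-scale : ∀ a q x → eval (scale a q) x ≈ a * eval q x
  eval-scale a []      x = sym (zeroʳ a)
  eval-scale a (b ∷ q) x = begin
    a * b + x * eval (scale a q) x  ≈⟨ +-congˡ (*-congˡ (eval-scale a q x)) ⟩
    a * b + x * (a * eval q x)      ≈⟨ solve 4 (λ a b x Q → a :* b :+ x :* (a :* Q) := a :* (b :+ x :* Q))
                                         refl a b x (eval q x) ⟩
    a * (b + x * eval q x)          ∎

  eval-*P : ∀ p q x → eval (p *P q) x ≈ eval p x * eval q x
  eval-*P []      q x = sym (zeroˡ _)
  eval-*P (a ∷ p) q x = begin
    eval (scale a q +P (0# ∷ (p *P q))) x          ≈⟨ eval-+P (scale a q) (0# ∷ (p *P q)) x ⟩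
    eval (scale a q) x + (0# + x * eval (p *P q) x) ≈⟨ +-cong (eval-scale a q x) (+-identityˡ _) ⟩
    a * eval q x + x * eval (p *P q) x             ≈⟨ +-congˡ (*-congˡ (eval-*P p q x)) ⟩
    a * eval q x + x * (eval p x * eval q x)       ≈⟨ solve 4 (λ a x P Q → a :* Q :+ x :* (P :* Q) := (a :+ x :* P) :* Q)
                                                        refl a x (eval p x) (eval q x) ⟩
    (a + x * eval p x) * eval q x                  ∎

  eval-negP : ∀ p x → eval (negP p) x ≈ - eval p x
  eval-negP []      x = sym -0#≈0#
  eval-negP (a ∷ p) x = begin
    - a + x * eval (negP p) x  ≈⟨ +-congˡ (*-congˡ (eval-negP p x)) ⟩
    - a + x * - eval p x       ≈⟨ +-congˡ (-‿distribʳ-* x (eval p x)) ⟨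
    - a + - (x * eval p x)     ≈⟨ -‿+-comm a (x * eval p x) ⟩
    - (a + x * eval p x)       ∎

  eval-const : ∀ a x → eval (const a) x ≈ a
  eval-const a x = trans (+-congˡ (zeroʳ x)) (+-identityʳ a)

  eval-lin : ∀ a b x → eval (lin a b) x ≈ a * (x - b)
  eval-lin a b x = begin
    - (a * b) + x * eval (const a) x  ≈⟨ +-congˡ (*-congˡ (eval-const a x)) ⟩
    - (a * b) + x * a                 ≈⟨ +-comm _ _ ⟩
    x * a + - (a * b)                 ≈⟨ +-cong (*-comm x a) (-‿distribʳ-* a b) ⟩
    a * x + a * - b                   ≈⟨ distribˡ a x (- b) ⟨
    a * (x - b)                       ∎

  eval-lin-root : ∀ a b → eval (lin a b) b ≈ 0#
  eval-lin-root a b = trans (eval-lin a b b) (trans (*-congˡ (-‿inverseʳ b)) (zeroʳ a))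

module SquareRecurrence {c ℓ} (K : Field c ℓ) where
  open Field K
  open FieldProperties K
  open NaturalSolver commutativeSemiring
  open ≈-Reasoning setoid

  outer-product : ∀ {x y z u t e₋ e₀ e₊} → ¬ z ≈ 0# →
    x * z ≈ e₋ * (y * y) → y * u ≈ e₀ * (z * z) → z * t ≈ e₊ * (u * u) →
    x * t ≈ (e₋ * e₀) * (e₀ * e₊) * (z * z)
  outer-product {x} {y} {z} {u} {t} {e₋} {e₀} {e₊} z≉0 xz≈ yu≈ zt≈ =
    *-cancelˡ-nonZero (z * z) _ _ (x≉0∧y≉0⇒xy≉0 z≉0 z≉0) (begin
      (z * z) * (x * t)                              ≈⟨ solve 3 (λ x z t → (z :* z) :* (x :* t) := (x :* z) :* (z :* t))
                                                          refl x z t ⟩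
      (x * z) * (z * t)                              ≈⟨ *-cong xz≈ zt≈ ⟩
      (e₋ * (y * y)) * (e₊ * (u * u))                ≈⟨ solve 4 (λ e₋ y e₊ u →
                                                          (e₋ :* (y :* y)) :* (e₊ :* (u :* u)) := (e₋ :* e₊) :* ((y :* u) :* (y :* u)))
                                                          refl e₋ y e₊ u ⟩
      (e₋ * e₊) * ((y * u) * (y * u))                ≈⟨ *-congˡ (*-cong yu≈ yu≈) ⟩
      (e₋ * e₊) * ((e₀ * (z * z)) * (e₀ * (z * z))) ≈⟨ solve 4 (λ e₋ e₀ e₊ z →
                                                          (e₋ :* e₊) :* ((e₀ :* (z :* z)) :* (e₀ :* (z :* z)))
                                                          := (z :* z) :* ((e₋ :* e₀) :* (e₀ :* e₊) :* (z :* z)))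
                                                          refl e₋ e₀ e₊ z ⟩
      (z * z) * ((e₋ * e₀) * (e₀ * e₊) * (z * z))    ∎)

  recurrence-two-apart : (As e : ℤ → Carrier) →
    (∀ i → As (i -ℤ + 1) * As (i +ℤ + 1) ≈ e i * (As i * As i)) →
    ∀ i → ¬ As i ≈ 0# →
    As (i -ℤ + 2) * As (i +ℤ + 2) ≈ (e (i -ℤ + 1) * e i) * (e i * e (i +ℤ + 1)) * (As i * As i)
  recurrence-two-apart As e recurrence i As≉0 =
    outer-product As≉0
      (recurrence-at (i -ℤ + 1) (i-1-1≡i-2 i) (i-1+1≡i i))
      (recurrence i)
      (recurrence-at (i +ℤ + 1) (i+1-1≡i i) (i+1+1≡i+2 i))
    where
    recurrence-at : ∀ m {j k} → m -ℤ + 1 ≡ j → m +ℤ + 1 ≡ k → As j * As k ≈ e m * (As m * As m)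
    recurrence-at m ≡.refl ≡.refl = recurrence m

module ContinuedFraction {c ℓ} (K : Field c ℓ) (c0 c1 v w : Field.Carrier K) where
  open Field K
  open Poly K
  open RingProperties ring
  open NaturalSolver commutativeSemiring
  open ≈-Reasoning setoid
  open FieldProperties K
  open Evaluation K

  A R : Pol
  A = monic2 c0 c1
  R = lin v w

  module Expansion (e vQ wQ : ℤ → Carrier) (vQ≉0 : ∀ i → ¬ vQ i ≈ 0#) (a : ℤ → Pol)
    (partial-quotient : ∀ i → (const (e i + e (i +ℤ + 1)) +P A) ≈P (a i *P lin (vQ i) (wQ i)))
    (norm : ∀ i → negP (lin (vQ i) (wQ i) *P lin (vQ (i +ℤ + 1)) (wQ (i +ℤ + 1)))
                    ≈P (negP R +P const (e (i +ℤ + 1)) *P (A +P const (e (i +ℤ + 1)))))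
    where

    Q : ℤ → Pol
    Q i = lin (vQ i) (wQ i)

    partial-quotient-at-root : ∀ i → (e i + e (i +ℤ + 1)) + eval A (wQ i) ≈ 0#
    partial-quotient-at-root i = begin
      (e i + e j) + eval A x                   ≈⟨ +-congʳ (eval-const _ x) ⟨
      eval (const (e i + e j)) x + eval A x    ≈⟨ eval-+P (const (e i + e j)) A x ⟨
      eval (const (e i + e j) +P A) x          ≈⟨ eval-cong (const (e i + e j) +P A) (a i *P Q i) x (partial-quotient i) ⟩
      eval (a i *P Q i) x                      ≈⟨ eval-*P (a i) (Q i) x ⟩
      eval (a i) x * eval (Q i) x              ≈⟨ *-congˡ (eval-lin-root (vQ i) x) ⟩
      eval (a i) x * 0#                        ≈⟨ zeroʳ _ ⟩
      0#                                       ∎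
      where
      j : ℤ
      j = i +ℤ + 1
      x : Carrier
      x = wQ i

    norm-at : ∀ i x → - (eval (Q i) x * eval (Q (i +ℤ + 1)) x)
                        ≈ - eval R x + e (i +ℤ + 1) * (eval A x + e (i +ℤ + 1))
    norm-at i x = begin
      - (eval (Q i) x * eval (Q j) x)                ≈⟨ -‿cong (eval-*P (Q i) (Q j) x) ⟨
      - eval (Q i *P Q j) x                          ≈⟨ eval-negP (Q i *P Q j) x ⟨
      eval (negP (Q i *P Q j)) x                     ≈⟨ eval-cong (negP (Q i *P Q j)) (negP R +P const t *P (A +P const t)) x (norm i) ⟩
      eval (negP R +P const t *P (A +P const t)) x   ≈⟨ eval-+P (negP R) (const t *P (A +P const t)) x ⟩
      eval (negP R) x + eval (const t *P (A +P const t)) x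
                                                     ≈⟨ +-cong (eval-negP R x) (eval-*P (const t) (A +P const t) x) ⟩
      - eval R x + eval (const t) x * eval (A +P const t) x
                                                     ≈⟨ +-congˡ (*-cong (eval-const t x)
                                                          (trans (eval-+P A (const t) x) (+-congˡ (eval-const t x)))) ⟩
      - eval R x + t * (eval A x + t)                ∎
      where
      j : ℤ
      j = i +ℤ + 1
      t : Carrier
      t = e j

    -- the X² coefficients of the two sides of norm
    leading-coefficient : ∀ i → - (vQ i * vQ (i +ℤ + 1)) ≈ e (i +ℤ + 1)
    leading-coefficient i = trans (norm i 2) (*-identityʳ _)

    e-suc≉0 : ∀ i → ¬ e (i +ℤ + 1) ≈ 0#
    e-suc≉0 i e≈0 = x≉0∧y≉0⇒xy≉0 (vQ≉0 i) (vQ≉0 (i +ℤ + 1))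
      (-‿injective (trans (trans (leading-coefficient i) e≈0) (sym -0#≈0#)))

    e-consecutive-product : ∀ i → e i * e (i +ℤ + 1) ≈ v * (w - wQ i)
    e-consecutive-product i = begin
      s * t           ≈⟨ -‿involutive (s * t) ⟨
      - - (s * t)     ≈⟨ +-inverseˡ-unique (- eval R x) (- (s * t)) -R-st≈0 ⟨
      - eval R x      ≈⟨ -‿cong (eval-lin v w x) ⟩
      - (v * (x - w)) ≈⟨ -‿distribʳ-* v (x - w) ⟩
      v * - (x - w)   ≈⟨ *-congˡ (⁻¹-anti-homo‿- x w) ⟩
      v * (w - x)     ∎
      where
      s t x α : Carrier
      s = e i
      t = e (i +ℤ + 1)
      x = wQ i
      α = eval A x
      α+t≈-s : α + t ≈ - s
      α+t≈-s = +-inverseˡ-unique (α + t) s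
        (trans (solve 3 (λ s t α → (α :+ t) :+ s := (s :+ t) :+ α) refl s t α) (partial-quotient-at-root i))
      -R-st≈0 : - eval R x + - (s * t) ≈ 0#
      -R-st≈0 = begin
        - eval R x + - (s * t)           ≈⟨ +-congˡ (-‿cong (*-comm s t)) ⟩
        - eval R x + - (t * s)           ≈⟨ +-congˡ (-‿distribʳ-* t s) ⟩
        - eval R x + t * - s             ≈⟨ +-congˡ (*-congˡ α+t≈-s) ⟨
        - eval R x + t * (α + t)         ≈⟨ norm-at i x ⟨
        - (eval (Q i) x * eval (Q (i +ℤ + 1)) x)
                                         ≈⟨ -‿cong (trans (*-congʳ (eval-lin-root (vQ i) x)) (zeroˡ _)) ⟩
        - 0#                             ≈⟨ -0#≈0# ⟩
        0#                               ∎

    root-distance-product : ∀ i → (w - wQ i) * (w - wQ (i +ℤ + 1)) ≈ eval A w + e (i +ℤ + 1)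
    root-distance-product i = *-cancelˡ-nonZero t _ _ (e-suc≉0 i) (begin
      t * (d * d′)                               ≈⟨ *-congʳ (leading-coefficient i) ⟨
      - (vQ i * vQ j) * (d * d′)                 ≈⟨ -‿distribˡ-* (vQ i * vQ j) (d * d′) ⟨
      - ((vQ i * vQ j) * (d * d′))               ≈⟨ -‿cong (solve 4 (λ p q d d′ →
                                                      (p :* q) :* (d :* d′) := (p :* d) :* (q :* d′))
                                                      refl (vQ i) (vQ j) d d′) ⟩
      - ((vQ i * d) * (vQ j * d′))               ≈⟨ -‿cong (*-cong (eval-lin (vQ i) (wQ i) w) (eval-lin (vQ j) (wQ j) w)) ⟨
      - (eval (Q i) w * eval (Q j) w)            ≈⟨ norm-at i w ⟩
      - eval R w + t * (eval A w + t)            ≈⟨ +-congʳ (trans (-‿cong (eval-lin-root v w)) -0#≈0#) ⟩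
      0# + t * (eval A w + t)                    ≈⟨ +-identityˡ _ ⟩
      t * (eval A w + t)                         ∎)
      where
      j : ℤ
      j = i +ℤ + 1
      t d d′ : Carrier
      t = e j
      d = w - wQ i
      d′ = w - wQ j

mainTheorem2 : ∀ {c ℓ : Level} (K : Field c ℓ) →
    let open Field K
        open Poly K
    in (c0 c1 : Carrier) → (v w : Carrier) → ¬ (v ≈ 0#) →
       (e : ℤ → Carrier) → (vQ wQ : ℤ → Carrier) → (∀ h → ¬ (vQ h ≈ 0#)) →
       (a : ℤ → Pol) →
       (∀ h → (const (e h + e (h +ℤ + 1)) +P monic2 c0 c1)
                ≈P (a h *P lin (vQ h) (wQ h))) →
       (∀ h → negP (lin (vQ h) (wQ h) *P lin (vQ (h +ℤ + 1)) (wQ (h +ℤ + 1)))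
                ≈P (negP (lin v w)
                     +P const (e (h +ℤ + 1)) *P (monic2 c0 c1 +P const (e (h +ℤ + 1))))) →
       (As : ℤ → Carrier) → (∀ h → ¬ (As h ≈ 0#)) →
       (∀ h → As (h -ℤ + 1) * As (h +ℤ + 1) ≈ e h * (As h * As h)) →
       ∀ h → As (h -ℤ + 2) * As (h +ℤ + 2)
               ≈ (v * v) * (As (h -ℤ + 1) * As (h +ℤ + 1))
                 + (v * v) * eval (monic2 c0 c1) w * (As h * As h)
mainTheorem2 K c0 c1 v w _ e vQ wQ vQ≉0 a partial-quotient norm As As≉0 recurrence h = begin
  As (h -ℤ + 2) * As (h +ℤ + 2)                    ≈⟨ recurrence-two-apart As e recurrence h (As≉0 h) ⟩
  (e (h -ℤ + 1) * e h) * (e h * e (h +ℤ + 1)) * z² ≈⟨ *-congʳ (*-cong e₋e≈vd₋ (e-consecutive-product h)) ⟩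
  (v * d₋) * (v * d) * z²                          ≈⟨ *-congʳ (solve 3 (λ v d₋ d → (v :* d₋) :* (v :* d) := (v :* v) :* (d₋ :* d))
                                                        refl v d₋ d) ⟩
  (v * v) * (d₋ * d) * z²                          ≈⟨ *-congʳ (*-congˡ d₋d≈Aw+e) ⟩
  (v * v) * (Aw + e h) * z²                        ≈⟨ solve 4 (λ v Aw eₕ z² → (v :* v) :* (Aw :+ eₕ) :* z²
                                                        := (v :* v) :* (eₕ :* z²) :+ (v :* v) :* Aw :* z²)
                                                        refl v Aw (e h) z² ⟩
  (v * v) * (e h * z²) + (v * v) * Aw * z²         ≈⟨ +-congʳ (*-congˡ (recurrence h)) ⟨
  (v * v) * (As (h -ℤ + 1) * As (h +ℤ + 1)) + (v * v) * Aw * z² ∎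
  where
  open Field K
  open Poly K
  open NaturalSolver commutativeSemiring
  open ≈-Reasoning setoid
  open SquareRecurrence K
  open ContinuedFraction.Expansion K c0 c1 v w e vQ wQ vQ≉0 a partial-quotient norm
  z² Aw d₋ d : Carrier
  z² = As h * As h
  Aw = eval (monic2 c0 c1) w
  d₋ = w - wQ (h -ℤ + 1)
  d = w - wQ h
  e₋e≈vd₋ : e (h -ℤ + 1) * e h ≈ v * d₋
  e₋e≈vd₋ = at-pred {P = λ i j → e i * e j ≈ v * (w - wQ i)} e-consecutive-product h
  d₋d≈Aw+e : d₋ * d ≈ Aw + e h
  d₋d≈Aw+e = at-pred {P = λ i j → (w - wQ i) * (w - wQ j) ≈ Aw + e j} root-distance-product h
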